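{- Let $k\in\omega\setminus\{0\}$, let $f_{i_1},\ldots,f_{i_n}\in\{f_1,\ldots,f_{m(k)}\}$ (with $n\in\omega$), and let $T=T_k^*(f_{i_1},0)\cdots(f_{i_n},0)$. If $T\neq\Lambda$, then $r(T)\ge\max(1,k-n)$.
   Context: Let $\omega=\{0,1,2,\ldots\}$, $\mathcal{P}(\omega)$ the set of nonempty finite subsets of $\omega$, $E_2=\{0,1\}$, and $P=\{f_i:i\in\omega\}$ a set of attributes. $\mathcal{M}_2^\infty$ is the set of rectangular tables filled with numbers from $E_2$ with pairwise different rows, each row labeled with a set from $\mathcal{P}(\omega)$ (its set of decisions), and columns labeled with pairwise different attributes from $P$ (the empty table $\Lambda$ with no rows included). For a table $T$ and a word $\alpha=(f_{i_1},\delta_1)\cdots(f_{i_m},\delta_m)$, $T\alpha$ is the subtable of rows having $\delta_j$ in the column labeled $f_{i_j}$ for all $j$. Graph $G_k$: for $k\ge1$ it has $m(k)=k(k+1)/2$ nodes arranged in layers $1,\ldots,k$, layer $i$ containing $i$ nodes $(i,1),\ldots,(i,i)$; node $(i,j)$ has number $(i-1)i/2+j$. For a node $(i,j)$ with $i<k$, its left child is $(i+1,j)$ and its right child is $(i+1,j+1)$; $l(x)$ and $p(x)$ denote the numbers of the left and right child of node number $x$. Define $\nu_k:E_2^{m(k)}\to\mathcal{P}(\omega)$: for $\bar\delta=(\delta_1,\ldots,\delta_{m(k)})$, $\nu_k(\bar\delta)\subseteq\{0,1,\ldots,m(k)\}$, where $0\in\nu_k(\bar\delta)$ iff $\delta_1=0$;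 for a node number $i$ not in layer $k$, $i\in\nu_k(\bar\delta)$ iff $\delta_i=1$ and $\delta_{l(i)}=\delta_{p(i)}=0$; for $i$ in layer $k$, $i\in\nu_k(\bar\delta)$ iff $\delta_i=1$. $T_k\in\mathcal{M}_2^\infty$ is the table with $m(k)$ columns labeled $f_1,\ldots,f_{m(k)}$ and all $2^{m(k)}$ rows of $E_2^{m(k)}$, each row $\bar\delta$ labeled with $\nu_k(\bar\delta)$. A complete path in $G_k$ is a directed path from node $1$ (layer 1) to a node of layer $k$, each step going from a node to one of its two children; its characteristic tuple is $(\delta_1,\ldots,\delta_{m(k)})\in E_2^{m(k)}$ with $\delta_i=1$ iff the path passes through node $i$. $T_k^*$ is the subtable of $T_k$ consisting of the rows that are characteristic tuples of complete paths of $G_k$. For a subtable $T$ of $T_k^*$ with rows $\bar\delta_1,\ldots,\bar\delta_t$, $r(T)=|\{\nu_k(\bar\delta_1),\ldots,\nu_k(\bar\delta_t)\}|$, the number of distinct decision sets among its rows. -}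

module Defs where

open import Data.Bool using (Bool; true; false; not; _∧_; if_then_else_)
open import Data.Nat using (ℕ; zero; suc; _+_; _∸_; _≡ᵇ_; _<ᵇ_)
open import Data.Nat.Properties using (_≟_)
open import Data.List using (List; []; _∷_; map; filterᵇ; upTo; length; concatMap; deduplicate)
open import Data.Bool.ListAction using (any)
open import Data.List.Properties using (≡-dec)
open import Data.Vec using (Vec; []; _∷_)
open import Data.Vec.Relation.Unary.All using (All)
open import Relation.Binary.PropositionalEquality using (_≡_)

-- m(k) = k(k+1)/2, number of nodes of G_k
m : ℕ → ℕ
m zero = zero
m (suc k) = m k + suc k

nodeNum : ℕ → ℕ → ℕ
nodeNum i j = m (i ∸ 1) + j

layer : ℕ → ℕ
layer x = length (filterᵇ (λ i → m i <ᵇ x) (upTo x))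

-- left / right child of node number x (not in the last layer)
lchild pchild : ℕ → ℕ
lchild x = x + layer x
pchild x = x + layer x + 1

-- A tuple (δ_1,…,δ_{m(k)}) is represented by δ : ℕ → Bool, δ_i = δ i
-- (only the positions 1 … m(k) are meaningful).
Tuple : Set
Tuple = ℕ → Bool

inν : ℕ → Tuple → ℕ → Bool
inν k δ zero = not (δ 1)
inν k δ (suc y) =
  if layer (suc y) ≡ᵇ k
  then δ (suc y)
  else (δ (suc y) ∧ not (δ (lchild (suc y))) ∧ not (δ (pchild (suc y))))

ν : ℕ → Tuple → List ℕ
ν k δ = filterᵇ (inν k δ) (upTo (suc (m k)))

-- A complete path of G_k (k ≥ 1): the sequence of k-1 choices
-- (false = left child, true = right child) starting from node 1 = (1,1).
Path : ℕ → Set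
Path k = Vec Bool (k ∸ 1)

visitedFrom : ∀ {l} → ℕ → ℕ → Vec Bool l → List ℕ
visitedFrom i j [] = nodeNum i j ∷ []
visitedFrom i j (b ∷ bs) =
  nodeNum i j ∷ visitedFrom (suc i) (if b then suc j else j) bs

visited : (k : ℕ) → Path k → List ℕ
visited k p = visitedFrom 1 1 p

charTuple : (k : ℕ) → Path k → Tuple
charTuple k p x = any (λ y → x ≡ᵇ y) (visited k p)

allVecs : (l : ℕ) → List (Vec Bool l)
allVecs zero = [] ∷ []
allVecs (suc l) = concatMap (λ v → (false ∷ v) ∷ (true ∷ v) ∷ []) (allVecs l)

-- rows of T_k^* : characteristic tuples of all complete paths of G_k
rowsT* : ℕ → List Tuple
rowsT* k = map (charTuple k) (allVecs (k ∸ 1))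

zeroAt : ∀ {n} → Vec ℕ n → Tuple → Bool
zeroAt [] δ = true
zeroAt (i ∷ is) δ = not (δ i) ∧ zeroAt is δ

rowsSub : ∀ {n} → ℕ → Vec ℕ n → List Tuple
rowsSub k is = filterᵇ (zeroAt is) (rowsT* k)

r : ℕ → List Tuple → ℕ
r k rows = length (deduplicate (≡-dec _≟_) (map (ν k) rows))

ValidAttr : ℕ → ℕ → Set
ValidAttr k i = 1 Data.Nat.≤ i Data.Product.× i Data.Nat.≤ m k
  where import Data.Product

{-# OPTIONS --safe #-}
-- A row of the restricted table is the characteristic tuple of a complete path of G_k that
-- avoids the nodes f_{i_1}, …, f_{i_n}, and ν of that row contains its leaf, so paths ending
-- at different leaves give different decision sets: r(T) is at least the number of leaves
-- reachable by avoiding paths. The positions reachable in layer l + 1 are the children of those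
-- reachable in layer l minus the forbidden nodes, and a nonempty set of c positions in a layer
-- has at least c + 1 children. Hence, once one avoiding path exists, the reachable positions
-- grow by one per layer up to the forbidden nodes, and layer k has at least k − n of them.
module Submission where

open import Defs
open import Data.Nat using (ℕ; _≤_; _∸_; _⊔_)
open import Data.Vec using (Vec)
open import Data.Vec.Relation.Unary.All using (All)
open import Data.List using ([])
open import Relation.Binary.PropositionalEquality using (_≢_)

open import Data.Bool using (Bool; true; false; not; _∧_; _∨_; if_then_else_; T)
open import Data.Bool.Properties using (∨-assoc; ∨-identityʳ; ∨-zeroʳ; ∧-zeroʳ; T-≡; T-∧)
open import Data.Bool.ListAction using (any)
open import Data.List using (List; _∷_; _++_; [_]; length; map; filterᵇ; applyUpTo; upTo; deduplicate)
open import Data.List.Membership.Propositional using (_∈_)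
open import Data.List.Membership.Propositional.Properties
  using (∈-map⁺; ∈-map⁻; ∈-concatMap⁺; ∈-filter⁺; ∈-filter⁻; ∈-upTo⁺; ∈-deduplicate⁺; ∈-++⁺ˡ; ∈-++⁺ʳ; ∈-++⁻; ∈-∃++)
open import Data.List.Properties using (≡-dec; length-++; length-map; filter-accept; filter-reject)
open import Data.List.Relation.Unary.Any using (here; there)
import Data.List.Relation.Unary.Any as Any
open import Data.List.Relation.Unary.Any.Properties using (any⁺; any⁻)
import Data.List.Relation.Unary.All as List
import Data.List.Relation.Unary.All.Properties as List
open import Data.List.Relation.Unary.AllPairs using ([]; _∷_)
open import Data.List.Relation.Unary.Unique.Propositional using (Unique)
open import Data.Nat using (zero; suc; _+_; _<_; z≤n; s≤s; s≤s⁻¹; _≡ᵇ_; _<ᵇ_)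
open import Data.Nat.Properties
open import Algebra.Properties.CommutativeSemigroup +-commutativeSemigroup using (interchange)
open import Data.Product using (Σ; Σ-syntax; ∃; _×_; _,_; proj₁; proj₂)
open import Data.Sum using (_⊎_; inj₁; inj₂)
open import Data.Vec using (_∷_; []; _∷ʳ_; initLast)
open import Function using (_∘_; _⇔_; mk⇔; Equivalence)
open import Relation.Binary.PropositionalEquality using (_≡_; refl; sym; trans; cong; subst)
open import Relation.Nullary using (Dec; yes; no; does; ¬_; contradiction)
open import Relation.Nullary.Decidable using (dec-true; map′; T?; _×-dec_; _⊎-dec_)

any-∷ʳ : ∀ {A : Set} (f : A → Bool) xs y → any f (xs ++ [ y ]) ≡ any f xs ∨ f y
any-∷ʳ f [] y = ∨-identityʳ (f y)
any-∷ʳ f (x ∷ xs) y rewrite any-∷ʳ f xs y = sym (∨-assoc (f x) (any f xs) (f y))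

nonempty⇒∈ : ∀ {A : Set} (xs : List A) → xs ≢ [] → ∃ (_∈ xs)
nonempty⇒∈ [] xs≢[] = contradiction refl xs≢[]
nonempty⇒∈ (x ∷ _) _ = x , here refl

unique-⊆⇒length-≤ : ∀ {A : Set} {xs ys : List A} → Unique xs → (∀ {x} → x ∈ xs → x ∈ ys) → length xs ≤ length ys
unique-⊆⇒length-≤ {xs = []} _ _ = z≤n
unique-⊆⇒length-≤ {xs = x ∷ xs} {ys} (x∉xs ∷ uniq) xs⊆ys with ∈-∃++ (xs⊆ys (here refl))
... | us , ws , refl = begin
  suc (length xs)         ≤⟨ s≤s (unique-⊆⇒length-≤ uniq xs⊆us++ws) ⟩
  suc (length (us ++ ws)) ≡⟨ cong suc (length-++ us) ⟩
  suc (length us + length ws) ≡⟨ sym (+-suc (length us) (length ws)) ⟩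
  length us + length (x ∷ ws) ≡⟨ sym (length-++ us) ⟩
  length (us ++ x ∷ ws)   ∎
  where
  open ≤-Reasoning
  xs⊆us++ws : ∀ {y} → y ∈ xs → y ∈ us ++ ws
  xs⊆us++ws {y} y∈xs with ∈-++⁻ us (xs⊆ys (there y∈xs))
  ... | inj₁ y∈us = ∈-++⁺ˡ y∈us
  ... | inj₂ (here refl) = contradiction refl (List.lookup x∉xs y∈xs)
  ... | inj₂ (there y∈ws) = ∈-++⁺ʳ us y∈ws

length-filterᵇ-applyUpTo : ∀ (P : ℕ → Bool) f c N → c ≤ N →
  (∀ {i} → i < c → T (P (f i))) → (∀ {i} → c ≤ i → ¬ T (P (f i))) →
  length (filterᵇ P (applyUpTo f N)) ≡ c
length-filterᵇ-applyUpTo P f zero zero _ _ _ = refl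
length-filterᵇ-applyUpTo P f zero (suc N) _ _ out
  rewrite filter-reject (T? ∘ P) {f 0} {applyUpTo (f ∘ suc) N} (out z≤n) =
  length-filterᵇ-applyUpTo P (f ∘ suc) zero N z≤n (λ ()) (λ _ → out z≤n)
length-filterᵇ-applyUpTo P f (suc c) (suc N) c≤N inside out
  rewrite filter-accept (T? ∘ P) {f 0} {applyUpTo (f ∘ suc) N} (inside (s≤s z≤n)) =
  cong suc (length-filterᵇ-applyUpTo P (f ∘ suc) c N (s≤s⁻¹ c≤N) (inside ∘ s≤s) (out ∘ s≤s))

toℕ : Bool → ℕ
toℕ false = 0
toℕ true = 1

count : (ℕ → Bool) → ℕ → ℕ → ℕ
count f a zero = 0
count f a (suc t) = toℕ (f a) + count f (suc a) t

count-+ : ∀ f a s t → count f a (s + t) ≡ count f a s + count f (s + a) t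
count-+ f a zero t = refl
count-+ f a (suc s) t rewrite count-+ f (suc a) s t | +-suc s a = sym (+-assoc (toℕ (f a)) _ _)

count-shift : ∀ f c a t → count (λ j → f (c + j)) a t ≡ count f (c + a) t
count-shift f c a zero = refl
count-shift f c a (suc t) rewrite count-shift f c (suc a) t | +-suc c a = refl

count-≤-+ : ∀ {f g h} a t → (∀ {j} → a ≤ j → toℕ (f j) ≤ toℕ (g j) + toℕ (h j)) →
            count f a t ≤ count g a t + count h a t
count-≤-+ a zero le = z≤n
count-≤-+ {f} {g} {h} a (suc t) le = ≤-trans
  (+-mono-≤ (le ≤-refl) (count-≤-+ (suc a) t (le ∘ ≤-trans (n≤1+n a))))
  (≤-reflexive (interchange (toℕ (g a)) (toℕ (h a)) (count g (suc a) t) (count h (suc a) t)))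

count-pos : ∀ {f} a t {j} → a ≤ j → j < a + t → f j ≡ true → 0 < count f a t
count-pos a zero a≤j j<a+0 fj = contradiction a≤j (<⇒≱ (subst (_ <_) (+-identityʳ a) j<a+0))
count-pos {f} a (suc t) {j} a≤j j<a+t fj with m≤n⇒m<n∨m≡n a≤j
... | inj₂ refl rewrite fj = s≤s z≤n
... | inj₁ a<j = ≤-trans (count-pos (suc a) t a<j (subst (j <_) (+-suc a t) j<a+t) fj)
                         (m≤n+m _ (toℕ (f a)))

-- Position j of the next layer is a child of positions j − 1 and j.
dilate : (ℕ → Bool) → ℕ → Bool
dilate f zero = f zero
dilate f (suc j) = f (suc j) ∨ f j

toℕ-dilate : ∀ f j → toℕ (f j) ≤ toℕ (dilate f j)
toℕ-dilate f zero = ≤-refl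
toℕ-dilate f (suc j) with f (suc j)
... | true = ≤-refl
... | false = z≤n

count-dilate : ∀ f a t → 0 < count f a t → suc (count f a t) ≤ count (dilate f) a (suc t)
count-dilate f a (suc t) pos with count f (suc a) t in rest
... | suc c = begin
  suc (toℕ (f a) + suc c)  ≡⟨ sym (+-suc (toℕ (f a)) (suc c)) ⟩
  toℕ (f a) + suc (suc c)  ≤⟨ +-mono-≤ (toℕ-dilate f a) (subst (λ x → suc x ≤ count (dilate f) (suc a) (suc t)) rest ih) ⟩
  toℕ (dilate f a) + count (dilate f) (suc a) (suc t) ∎
  where
  open ≤-Reasoning
  ih : suc (count f (suc a) t) ≤ count (dilate f) (suc a) (suc t)
  ih = count-dilate f (suc a) t (subst (0 <_) (sym rest) (s≤s z≤n))
count-dilate f a (suc t) pos | zero with f a in fa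
... | true rewrite ∨-zeroʳ (f (suc a)) = +-mono-≤ (subst (λ b → toℕ b ≤ toℕ (dilate f a)) fa (toℕ-dilate f a)) (s≤s z≤n)
count-dilate f a (suc t) () | zero | false

count-false : ∀ a t → count (λ _ → false) a t ≡ 0
count-false a zero = refl
count-false a (suc t) = count-false (suc a) t

count-≡ᵇ-above : ∀ i a t → i < a → count (i ≡ᵇ_) a t ≡ 0
count-≡ᵇ-above i a zero _ = refl
count-≡ᵇ-above i a (suc t) i<a with i ≡ᵇ a in i≡ᵇa
... | true = contradiction (≡ᵇ⇒≡ i a (Equivalence.from T-≡ i≡ᵇa)) (<⇒≢ i<a)
... | false = count-≡ᵇ-above i (suc a) t (m<n⇒m<1+n i<a)

count-≡ᵇ≤1 : ∀ i a t → count (i ≡ᵇ_) a t ≤ 1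
count-≡ᵇ≤1 i a zero = z≤n
count-≡ᵇ≤1 i a (suc t) with i ≡ᵇ a in i≡ᵇa
... | true rewrite count-≡ᵇ-above i (suc a) t (s≤s (≤-reflexive (≡ᵇ⇒≡ i a (Equivalence.from T-≡ i≡ᵇa)))) = ≤-refl
... | false = count-≡ᵇ≤1 i (suc a) t

infix 4 _∉ᵇ_
_∉ᵇ_ : ∀ {n} → ℕ → Vec ℕ n → Bool
v ∉ᵇ is = zeroAt is (_≡ᵇ v)

count-∈≤length : ∀ {n} (is : Vec ℕ n) a t → count (λ v → not (v ∉ᵇ is)) a t ≤ n
count-∈≤length [] a t = ≤-reflexive (count-false a t)
count-∈≤length (i ∷ is) a t = ≤-trans (count-≤-+ a t (λ {v} _ → not-∧-bound (i ≡ᵇ v) (v ∉ᵇ is)))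
                                      (+-mono-≤ (count-≡ᵇ≤1 i a t) (count-∈≤length is a t))
  where
  not-∧-bound : ∀ x y → toℕ (not (not x ∧ y)) ≤ toℕ x + toℕ (not y)
  not-∧-bound true y = s≤s z≤n
  not-∧-bound false true = z≤n
  not-∧-bound false false = ≤-refl

zeroAt-∨ : ∀ {n} (is : Vec ℕ n) {f g h : ℕ → Bool} → (∀ x → h x ≡ f x ∨ g x) →
           zeroAt is h ≡ zeroAt is f ∧ zeroAt is g
zeroAt-∨ [] h≗ = refl
zeroAt-∨ (i ∷ is) {f} {g} {h} h≗ rewrite h≗ i | zeroAt-∨ is h≗ with f i | g i
... | true | _ = refl
... | false | true = sym (∧-zeroʳ (zeroAt is f))
... | false | false = refl

m-mono-≤ : ∀ {a b} → a ≤ b → m a ≤ m b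
m-mono-≤ {zero} _ = z≤n
m-mono-≤ {suc a} {suc b} (s≤s a≤b) = +-mono-≤ (m-mono-≤ a≤b) (s≤s a≤b)

n≤m : ∀ n → n ≤ m n
n≤m zero = z≤n
n≤m (suc n) = m≤n+m (suc n) (m n)

step : Bool → ℕ → ℕ
step b j = if b then suc j else j

endFrom : ∀ {l} → ℕ → Vec Bool l → ℕ
endFrom j [] = j
endFrom j (b ∷ bs) = endFrom (step b j) bs

endpoint : ∀ {l} → Vec Bool l → ℕ
endpoint = endFrom 1

endFrom-∷ʳ : ∀ {l} j (bs : Vec Bool l) b → endFrom j (bs ∷ʳ b) ≡ step b (endFrom j bs)
endFrom-∷ʳ j [] b = refl
endFrom-∷ʳ j (c ∷ bs) b = endFrom-∷ʳ (step c j) bs b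

endFrom-≥ : ∀ {l} j (bs : Vec Bool l) → j ≤ endFrom j bs
endFrom-≥ j [] = ≤-refl
endFrom-≥ j (false ∷ bs) = endFrom-≥ j bs
endFrom-≥ j (true ∷ bs) = ≤-trans (n≤1+n j) (endFrom-≥ (suc j) bs)

endFrom-≤ : ∀ {l} j (bs : Vec Bool l) → endFrom j bs ≤ j + l
endFrom-≤ j [] = ≤-reflexive (sym (+-identityʳ j))
endFrom-≤ {suc l} j (false ∷ bs) = ≤-trans (endFrom-≤ j bs) (+-monoʳ-≤ j (n≤1+n l))
endFrom-≤ {suc l} j (true ∷ bs) = ≤-trans (endFrom-≤ (suc j) bs) (≤-reflexive (sym (+-suc j l)))

visitedFrom-∷ʳ : ∀ {l} i j (bs : Vec Bool l) b →
  visitedFrom i j (bs ∷ʳ b) ≡ visitedFrom i j bs ++ [ nodeNum (suc (i + l)) (step b (endFrom j bs)) ]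
visitedFrom-∷ʳ i j [] b rewrite +-identityʳ i = refl
visitedFrom-∷ʳ {suc l} i j (c ∷ bs) b rewrite visitedFrom-∷ʳ (suc i) (step c j) bs b | +-suc i l = refl

charTuple-∷ʳ : ∀ {l} (q : Vec Bool l) b x →
  charTuple (suc (suc l)) (q ∷ʳ b) x ≡ charTuple (suc l) q x ∨ (x ≡ᵇ m (suc l) + step b (endpoint q))
charTuple-∷ʳ q b x rewrite visitedFrom-∷ʳ 1 1 q b = any-∷ʳ (x ≡ᵇ_) (visitedFrom 1 1 q) _

T-charTuple⇔∈ : ∀ k (p : Path k) x → T (charTuple k p x) ⇔ x ∈ visited k p
T-charTuple⇔∈ k p x = mk⇔ (λ t → Any.map (λ {y} → ≡ᵇ⇒≡ x y) (any⁻ _ (visited k p) t))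
                          (λ x∈ → any⁺ _ (Any.map (λ {y} → ≡⇒≡ᵇ x y) x∈))

visited-split : ∀ l (p : Vec Bool l) →
  Σ[ us ∈ List ℕ ] List.All (_≤ m l) us × visitedFrom 1 1 p ≡ us ++ [ m l + endpoint p ]
visited-split zero [] = [] , List.[] , refl
visited-split (suc l) p with initLast p
... | q , b , refl with visited-split l q
... | us , us≤ , eq = us ++ [ m l + endpoint q ] , all≤ , split
  where
  all≤ : List.All (_≤ m (suc l)) (us ++ [ m l + endpoint q ])
  all≤ = List.++⁺ (List.map (λ u≤ → ≤-trans u≤ (m≤m+n (m l) (suc l))) us≤)
                  (+-monoʳ-≤ (m l) (endFrom-≤ 1 q) List.∷ List.[])
  split : visitedFrom 1 1 (q ∷ʳ b) ≡ (us ++ [ m l + endpoint q ]) ++ [ m (suc l) + endpoint (q ∷ʳ b) ]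
  split rewrite visitedFrom-∷ʳ 1 1 q b | eq | endFrom-∷ʳ 1 q b = refl

leaf-∈-visited : ∀ l (p : Vec Bool l) → m l + endpoint p ∈ visitedFrom 1 1 p
leaf-∈-visited l p with visited-split l p
... | us , _ , eq = subst (_ ∈_) (sym eq) (∈-++⁺ʳ us (here refl))

leaf-∈-visited⇒endpoint : ∀ l (q : Vec Bool l) {j} → 1 ≤ j → m l + j ∈ visitedFrom 1 1 q → j ≡ endpoint q
leaf-∈-visited⇒endpoint l q {j} 1≤j x∈ with visited-split l q
... | us , us≤ , eq with ∈-++⁻ us (subst (_ ∈_) eq x∈)
...   | inj₁ x∈us = contradiction (List.lookup us≤ x∈us) (<⇒≱ (m<m+n (m l) 1≤j))
...   | inj₂ (here x≡) = +-cancelˡ-≡ (m l) _ _ x≡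

layer-leaf : ∀ l {j} → 1 ≤ j → j ≤ suc l → layer (m l + j) ≡ suc l
layer-leaf l {j} 1≤j j≤ = length-filterᵇ-applyUpTo (λ i → m i <ᵇ (m l + j)) (λ i → i) (suc l) (m l + j)
  (≤-trans (s≤s (n≤m l)) (m<m+n (m l) 1≤j))
  (λ i≤l → <⇒<ᵇ (≤-<-trans (m-mono-≤ (s≤s⁻¹ i≤l)) (m<m+n (m l) 1≤j)))
  (λ {i} l<i t → <⇒≱ (<ᵇ⇒< (m i) _ t) (≤-trans (+-monoʳ-≤ (m l) j≤) (m-mono-≤ l<i)))

inν-leaf : ∀ k δ {x} → 1 ≤ x → layer x ≡ k → inν k δ x ≡ δ x
inν-leaf k δ {suc y} _ layer≡ rewrite layer≡ | Equivalence.to T-≡ (≡⇒≡ᵇ k k refl) = refl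

leaf-∈ν⇔ : ∀ l δ {j} → 1 ≤ j → j ≤ suc l → (m l + j ∈ ν (suc l) δ) ⇔ T (δ (m l + j))
leaf-∈ν⇔ l δ {j} 1≤j j≤ = mk⇔
  (λ x∈ → subst T inν≡ (proj₂ (∈-filter⁻ (T? ∘ inν (suc l) δ) {xs = upTo (suc (m (suc l)))} x∈)))
  (λ t → ∈-filter⁺ (T? ∘ inν (suc l) δ) (∈-upTo⁺ (s≤s (+-monoʳ-≤ (m l) j≤))) (subst T (sym inν≡) t))
  where
  inν≡ : inν (suc l) δ (m l + j) ≡ δ (m l + j)
  inν≡ = inν-leaf (suc l) δ (≤-trans 1≤j (m≤n+m j (m l))) (layer-leaf l 1≤j j≤)

-- The leaf m l + endpoint p lies in the decision set of p and in no other.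
ν-separates : ∀ l (p q : Vec Bool l) → endpoint p ≢ endpoint q →
  ν (suc l) (charTuple (suc l) p) ≢ ν (suc l) (charTuple (suc l) q)
ν-separates l p q end≢ ν≡ = end≢ (leaf-∈-visited⇒endpoint l q 1≤e leaf∈q)
  where
  1≤e : 1 ≤ endpoint p
  1≤e = endFrom-≥ 1 p
  e≤ : endpoint p ≤ suc l
  e≤ = endFrom-≤ 1 p
  leaf∈νp : m l + endpoint p ∈ ν (suc l) (charTuple (suc l) p)
  leaf∈νp = Equivalence.from (leaf-∈ν⇔ l (charTuple (suc l) p) 1≤e e≤)
              (Equivalence.from (T-charTuple⇔∈ (suc l) p _) (leaf-∈-visited l p))
  leaf∈q : m l + endpoint p ∈ visitedFrom 1 1 q
  leaf∈q = Equivalence.to (T-charTuple⇔∈ (suc l) q _)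
             (Equivalence.to (leaf-∈ν⇔ l (charTuple (suc l) q) 1≤e e≤) (subst (_ ∈_) ν≡ leaf∈νp))

allVecs-complete : ∀ {l} (v : Vec Bool l) → v ∈ allVecs l
allVecs-complete [] = here refl
allVecs-complete (b ∷ v) = ∈-concatMap⁺ _ (Any.map (λ { refl → choose b }) (allVecs-complete v))
  where
  choose : ∀ b → b ∷ v ∈ (false ∷ v) ∷ (true ∷ v) ∷ []
  choose false = here refl
  choose true = there (here refl)

module _ {n} (is : Vec ℕ n) where

  AvoidingPath : ℕ → ℕ → Set
  AvoidingPath l j = Σ[ p ∈ Vec Bool l ] endpoint p ≡ j × T (zeroAt is (charTuple (suc l) p))

  zeroAt-∷ʳ : ∀ {l} (q : Vec Bool l) b → zeroAt is (charTuple (suc (suc l)) (q ∷ʳ b)) ≡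
              zeroAt is (charTuple (suc l) q) ∧ (m (suc l) + step b (endpoint q) ∉ᵇ is)
  zeroAt-∷ʳ q b = zeroAt-∨ is (charTuple-∷ʳ q b)

  extend : ∀ {l j} b → AvoidingPath l j → T (m (suc l) + step b j ∉ᵇ is) → AvoidingPath (suc l) (step b j)
  extend b (q , refl , avoids) free =
    q ∷ʳ b , endFrom-∷ʳ 1 q b , subst T (sym (zeroAt-∷ʳ q b)) (Equivalence.from T-∧ (avoids , free))

  extend⁻ : ∀ {l j} → AvoidingPath (suc l) j →
            Σ[ b ∈ Bool ] Σ[ i ∈ ℕ ] step b i ≡ j × AvoidingPath l i × T (m (suc l) + j ∉ᵇ is)
  extend⁻ {l} (p , end≡ , avoids) with initLast p
  ... | q , b , refl with Equivalence.to T-∧ (subst T (zeroAt-∷ʳ q b) avoids)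
  ...   | avoids′ , free = b , endpoint q , step≡ , (q , refl , avoids′) , subst (λ j → T (m (suc l) + j ∉ᵇ is)) step≡ free
    where
    step≡ : step b (endpoint q) ≡ _
    step≡ = trans (sym (endFrom-∷ʳ 1 q b)) end≡

  avoidingPath-suc⇔ : ∀ l j → AvoidingPath (suc l) (suc j) ⇔
                      (T (m (suc l) + suc j ∉ᵇ is) × (AvoidingPath l (suc j) ⊎ AvoidingPath l j))
  avoidingPath-suc⇔ l j = mk⇔ to from
    where
    to : AvoidingPath (suc l) (suc j) → T (m (suc l) + suc j ∉ᵇ is) × (AvoidingPath l (suc j) ⊎ AvoidingPath l j)
    to w with extend⁻ w
    ... | false , _ , refl , w′ , free = free , inj₁ w′
    ... | true , _ , refl , w′ , free = free , inj₂ w′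
    from : T (m (suc l) + suc j ∉ᵇ is) × (AvoidingPath l (suc j) ⊎ AvoidingPath l j) → AvoidingPath (suc l) (suc j)
    from (free , inj₁ w′) = extend false w′ free
    from (free , inj₂ w′) = extend true w′ free

  reachable? : ∀ l j → Dec (AvoidingPath l j)
  reachable? zero j = map′ (λ (e , z) → [] , e , z) (λ { ([] , e , z) → e , z })
                           ((1 ≟ j) ×-dec T? (zeroAt is (charTuple 1 [])))
  reachable? (suc l) zero = no λ (p , end≡ , _) → contradiction (subst (1 ≤_) end≡ (endFrom-≥ 1 p)) λ ()
  reachable? (suc l) (suc j) = map′ (Equivalence.from (avoidingPath-suc⇔ l j)) (Equivalence.to (avoidingPath-suc⇔ l j))
                                    (T? _ ×-dec (reachable? l (suc j) ⊎-dec reachable? l j))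

  reached : ℕ → ℕ → Bool
  reached l j = does (reachable? l j)

  reachedCount : ℕ → ℕ
  reachedCount l = count (reached l) 1 (suc l)

  forbiddenCount : ℕ → ℕ
  forbiddenCount l = count (λ v → not (v ∉ᵇ is)) 1 (m (suc l))

  reachedCount-pos : ∀ {l j} → AvoidingPath l j → 0 < reachedCount l
  reachedCount-pos {l} {j} w@(p , end≡ , _) =
    count-pos 1 (suc l) (subst (1 ≤_) end≡ (endFrom-≥ 1 p)) (s≤s (subst (_≤ suc l) end≡ (endFrom-≤ 1 p)))
              (dec-true (reachable? l j) w)

  forbiddenInLayer : ℕ → ℕ
  forbiddenInLayer l = count (λ j → not (m l + j ∉ᵇ is)) 1 (suc l)

  forbiddenCount-suc : ∀ l → forbiddenCount (suc l) ≡ forbiddenCount l + forbiddenInLayer (suc l)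
  forbiddenCount-suc l = trans (count-+ forbidden 1 (m (suc l)) (suc (suc l)))
                               (cong (forbiddenCount l +_) (sym (count-shift forbidden (m (suc l)) 1 (suc (suc l)))))
    where
    forbidden : ℕ → Bool
    forbidden v = not (v ∉ᵇ is)

  dilate-reached-≤ : ∀ l {j} → 1 ≤ j →
    toℕ (dilate (reached l) j) ≤ toℕ (reached (suc l) j) + toℕ (not (m (suc l) + j ∉ᵇ is))
  dilate-reached-≤ l {suc j} _ = prune (m (suc l) + suc j ∉ᵇ is) (reached l (suc j) ∨ reached l j)
    where
    prune : ∀ a b → toℕ b ≤ toℕ (a ∧ b) + toℕ (not a)
    prune true b = ≤-reflexive (sym (+-identityʳ (toℕ b)))
    prune false true = ≤-refl
    prune false false = z≤n

  reachedCount-lowerBound : ∀ l {j} → AvoidingPath l j → suc l ≤ reachedCount l + forbiddenCount l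
  reachedCount-lowerBound zero w = ≤-trans (reachedCount-pos w) (m≤m+n _ _)
  reachedCount-lowerBound (suc l) w with extend⁻ w
  ... | _ , _ , _ , w′ , _ = begin
    suc (suc l)                                                     ≤⟨ s≤s (reachedCount-lowerBound l w′) ⟩
    suc (reachedCount l) + forbiddenCount l                         ≤⟨ +-monoˡ-≤ _ children ⟩
    count (dilate (reached l)) 1 (suc (suc l)) + forbiddenCount l   ≤⟨ +-monoˡ-≤ _ pruned ⟩
    (reachedCount (suc l) + forbiddenInLayer (suc l)) + forbiddenCount l
                                                                    ≡⟨ +-assoc (reachedCount (suc l)) _ _ ⟩
    reachedCount (suc l) + (forbiddenInLayer (suc l) + forbiddenCount l)
                                                                    ≡⟨ cong (reachedCount (suc l) +_) (+-comm _ (forbiddenCount l)) ⟩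
    reachedCount (suc l) + (forbiddenCount l + forbiddenInLayer (suc l))
                                                                    ≡⟨ cong (reachedCount (suc l) +_) (sym (forbiddenCount-suc l)) ⟩
    reachedCount (suc l) + forbiddenCount (suc l)                   ∎
    where
    open ≤-Reasoning
    children : suc (reachedCount l) ≤ count (dilate (reached l)) 1 (suc (suc l))
    children = count-dilate (reached l) 1 (suc l) (reachedCount-pos w′)
    pruned : count (dilate (reached l)) 1 (suc (suc l)) ≤ reachedCount (suc l) + forbiddenInLayer (suc l)
    pruned = count-≤-+ {g = reached (suc l)} 1 (suc (suc l)) (dilate-reached-≤ l)

  leaves : ∀ l → ℕ → ℕ → List (Σ ℕ (AvoidingPath l))
  leaves l a zero = []
  leaves l a (suc t) with reachable? l a
  ... | yes w = (a , w) ∷ leaves l (suc a) t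
  ... | no _ = leaves l (suc a) t

  length-leaves : ∀ l a t → length (leaves l a t) ≡ count (reached l) a t
  length-leaves l a zero = refl
  length-leaves l a (suc t) with reachable? l a
  ... | yes _ = cong suc (length-leaves l (suc a) t)
  ... | no _ = length-leaves l (suc a) t

  leaves-≥ : ∀ l a t → List.All ((a ≤_) ∘ proj₁) (leaves l a t)
  leaves-≥ l a zero = List.[]
  leaves-≥ l a (suc t) with reachable? l a
  ... | yes _ = ≤-refl List.∷ List.map (≤-trans (n≤1+n a)) (leaves-≥ l (suc a) t)
  ... | no _ = List.map (≤-trans (n≤1+n a)) (leaves-≥ l (suc a) t)

  decisionSet : ∀ {l} → Σ ℕ (AvoidingPath l) → List ℕ
  decisionSet {l} (_ , p , _) = ν (suc l) (charTuple (suc l) p)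

  decisionSets-unique : ∀ l a t → Unique (map decisionSet (leaves l a t))
  decisionSets-unique l a zero = []
  decisionSets-unique l a (suc t) with reachable? l a
  ... | yes (p , end≡ , _) =
    List.map⁺ (List.map (λ { {j , q , refl , _} a<j → ν-separates l p q (λ e → <⇒≢ a<j (trans (sym end≡) e)) })
                        (leaves-≥ l (suc a) t))
    ∷ decisionSets-unique l (suc a) t
  ... | no _ = decisionSets-unique l (suc a) t

  decisionSet-∈ : ∀ {l} (w : Σ ℕ (AvoidingPath l)) → decisionSet w ∈ map (ν (suc l)) (rowsSub (suc l) is)
  decisionSet-∈ {l} (_ , p , _ , avoids) =
    ∈-map⁺ (ν (suc l)) (∈-filter⁺ (T? ∘ zeroAt is) (∈-map⁺ (charTuple (suc l)) (allVecs-complete p)) avoids)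

  reachedCount≤r : ∀ l → reachedCount l ≤ r (suc l) (rowsSub (suc l) is)
  reachedCount≤r l = subst (_≤ r (suc l) (rowsSub (suc l) is))
    (trans (length-map decisionSet (leaves l 1 (suc l))) (length-leaves l 1 (suc l)))
    (unique-⊆⇒length-≤ (decisionSets-unique l 1 (suc l)) sets⊆)
    where
    sets⊆ : ∀ {x} → x ∈ map decisionSet (leaves l 1 (suc l)) → x ∈ deduplicate (≡-dec _≟_) (map (ν (suc l)) (rowsSub (suc l) is))
    sets⊆ x∈ with ∈-map⁻ decisionSet x∈
    ... | w , _ , refl = ∈-deduplicate⁺ (≡-dec _≟_) (decisionSet-∈ w)

  row⇒avoidingPath : ∀ l {δ} → δ ∈ rowsSub (suc l) is → ∃ (AvoidingPath l)
  row⇒avoidingPath l δ∈ with ∈-filter⁻ (T? ∘ zeroAt is) {xs = map (charTuple (suc l)) (allVecs l)} δ∈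
  ... | δ∈rows , avoids with ∈-map⁻ (charTuple (suc l)) δ∈rows
  ...   | p , _ , refl = endpoint p , p , refl , avoids

lemma8 : (k : ℕ) → 1 ≤ k → (n : ℕ) → (is : Vec ℕ n) → All (ValidAttr k) is →
         rowsSub k is ≢ [] → 1 ⊔ (k ∸ n) ≤ r k (rowsSub k is)
lemma8 zero () _ _ _ _
lemma8 (suc l) _ n is _ rows≢[] with row⇒avoidingPath is l (proj₂ (nonempty⇒∈ (rowsSub (suc l) is) rows≢[]))
... | _ , w = ≤-trans (⊔-lub (reachedCount-pos is w) lowerBound) (reachedCount≤r is l)
  where
  open ≤-Reasoning
  lowerBound : suc l ∸ n ≤ reachedCount is l
  lowerBound = m≤n+o⇒m∸n≤o (suc l) n (begin
    suc l                                   ≤⟨ reachedCount-lowerBound is l w ⟩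
    reachedCount is l + forbiddenCount is l ≤⟨ +-monoʳ-≤ _ (count-∈≤length is 1 (m (suc l))) ⟩
    reachedCount is l + n                   ≡⟨ +-comm _ n ⟩
    n + reachedCount is l                   ∎)
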